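{- For any permutation $\sigma\in\mathfrak S_n$, $$V(\sigma)=2\big(N_{21}(\sigma)+N_{231}(\sigma)+N_{312}(\sigma)+N_{321}(\sigma)\big).$$
   Context: $V(\sigma)=\sum_{i=1}^n(\sigma_i-i)^2$. For a permutation $\pi\in\mathfrak S_k$, $N_\pi(\sigma)$ is the number of choices of positions $i_1<\dots<i_k$ such that $\sigma_{i_1}\cdots\sigma_{i_k}$ is order-isomorphic to $\pi$ (classical pattern count). -}

module Defs where

open import Data.Nat using (ℕ; zero; suc; _<_; _<ᵇ_)
open import Data.Nat.Properties using ()
open import Data.Bool using (Bool; true; false; _∧_; _∨_; not)
open import Data.Fin using (Fin; toℕ)
open import Data.Fin.Permutation using (Permutation′; _⟨$⟩ʳ_)
open import Data.List using (List; []; _∷_; map; length; filter; sum; allFin; _++_; foldr)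
open import Data.Vec using (Vec; []; _∷_; lookup)
open import Data.Integer using (ℤ; +_; _-_; _*_; _+_)
open import Data.Fin.Base using (zero; suc)

_==ᵇ_ : Bool → Bool → Bool
true ==ᵇ b = b
false ==ᵇ b = not b

-- All k-element subsequences of a list (order preserved), i.e. all choices
-- of positions i₁ < … < i_k when applied to  allFin n.
choose : {A : Set} → (k : ℕ) → List A → List (Vec A k)
choose zero xs = [] ∷ []
choose (suc k) [] = []
choose (suc k) (x ∷ xs) = map (x ∷_) (choose k xs) ++ choose (suc k) xs

allPairs : (k : ℕ) → (Fin k → Fin k → Bool) → Bool
allPairs k P = foldr (λ a acc → foldr (λ b acc′ → P a b ∧ acc′) acc (allFin k)) true (allFin k)

orderIso : {n k : ℕ} → Permutation′ n → Permutation′ k → Vec (Fin n) k → Bool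
orderIso {n} {k} σ π is =
  allPairs k (λ a b →
    (toℕ (σ ⟨$⟩ʳ lookup is a) <ᵇ toℕ (σ ⟨$⟩ʳ lookup is b))
      ==ᵇ (toℕ (π ⟨$⟩ʳ a) <ᵇ toℕ (π ⟨$⟩ʳ b)))

N : {n k : ℕ} → Permutation′ k → Permutation′ n → ℕ
N {n} {k} π σ = length (filter (λ is → orderIso σ π is Data.Bool.≟ true) (choose k (allFin n)))

-- V(σ) = Σ_i (σ_i - i)²  (0-indexed; the shift cancels in σ_i - i)
V : {n : ℕ} → Permutation′ n → ℤ
V {n} σ = sumℤ (map (λ i → let d = (+ toℕ (σ ⟨$⟩ʳ i)) - (+ toℕ i) in d * d) (allFin n))
  where
  sumℤ : List ℤ → ℤ
  sumℤ = foldr _+_ (+ 0)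

open import Relation.Binary.PropositionalEquality using (_≡_; refl)
open import Data.Fin.Permutation using (permutation)

-- The patterns, in one-line notation (values 0-indexed).
-- 21
p21 : Permutation′ 2
p21 = permutation f f inv inv
  where
  f : Fin 2 → Fin 2
  f zero = suc zero
  f (suc zero) = zero
  inv : ∀ x → f (f x) ≡ x
  inv zero = refl
  inv (suc zero) = refl

p321 : Permutation′ 3
p321 = permutation f f inv inv
  where
  f : Fin 3 → Fin 3
  f zero = suc (suc zero)
  f (suc zero) = suc zero
  f (suc (suc zero)) = zero
  inv : ∀ x → f (f x) ≡ x
  inv zero = refl
  inv (suc zero) = refl
  inv (suc (suc zero)) = refl

f231 : Fin 3 → Fin 3
f231 zero = suc zero
f231 (suc zero) = suc (suc zero)
f231 (suc (suc zero)) = zero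

f312 : Fin 3 → Fin 3
f312 zero = suc (suc zero)
f312 (suc zero) = zero
f312 (suc (suc zero)) = suc zero

inv₁ : ∀ x → f231 (f312 x) ≡ x
inv₁ zero = refl
inv₁ (suc zero) = refl
inv₁ (suc (suc zero)) = refl

inv₂ : ∀ x → f312 (f231 x) ≡ x
inv₂ zero = refl
inv₂ (suc zero) = refl
inv₂ (suc (suc zero)) = refl

p231 : Permutation′ 3
p231 = permutation f231 f312 inv₁ inv₂

p312 : Permutation′ 3
p312 = permutation f312 f231 inv₂ inv₁

-- For the entry at position x let c, a and b count the entries that are earlier and smaller, later and
-- smaller, and earlier and larger.  Then σ(x) = c + a and x = c + b, so (σ(x) − x)² = a² + b² − 2ab.
-- Summed over x, Σ a and Σ b both count inversions, Σ a(a−1)/2 counts the occurrences of 312 and 321 in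
-- which x is the first letter, Σ b(b−1)/2 those of 231 and 321 in which x is the last, and Σ ab those of
-- 321 with x in the middle; writing a² = a + 2·a(a−1)/2 gives
-- V = 2 N₂₁ + 2 (N₃₁₂ + N₃₂₁) + 2 (N₂₃₁ + N₃₂₁) − 2 N₃₂₁.

module Submission where

open import Defs
open import Data.Bool.Base using (Bool; true; false)
open import Data.Bool.Properties using () renaming (_≟_ to _≟ᵇ_)
open import Data.Nat.Base using (ℕ; zero; suc; _+_; _*_; _<ᵇ_; _<_; _≤_; _≥_; z≤n; s≤s; z<s; s<s)
open import Data.Nat.Properties
  using (*-zeroʳ; *-distribˡ-+; *-comm; *-identityˡ; *-suc; +-assoc; +-identityʳ; <-cmp; <-irrefl; <-trans; ≤-refl; <⇒≤;
         +-0-commutativeMonoid)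
open import Data.Nat.Tactic.RingSolver using (solve-∀)
open import Data.List.Base using (List; []; _∷_; _++_; map; length; filter; foldr; allFin; tabulate)
open import Data.List.Relation.Unary.All as All using (All; []; _∷_)
open import Data.List.Relation.Unary.AllPairs using (AllPairs; []; _∷_)
open import Data.Product.Base using (_×_; _,_; proj₁; proj₂; map₁)
open import Data.Vec.Base as Vec using (Vec; []; _∷_; lookup)
open import Data.Fin.Base as Fin using (Fin; toℕ)
open import Data.Fin.Properties using (toℕ-injective; toℕ<n)
open import Data.Fin.Permutation using (Permutation′; _⟨$⟩ʳ_; _⟨$⟩ˡ_; inverseˡ)
open import Algebra.Properties.CommutativeMonoid.Sum +-0-commutativeMonoid using (sum; sum-permute)
import Data.List.Relation.Unary.AllPairs as AllPairs
open import Data.List.Relation.Unary.AllPairs.Properties using (tabulate⁺-<)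
import Data.List.Relation.Unary.All.Properties as All
open import Data.Integer.Base as ℤ using (ℤ; +_)
import Data.Integer.Properties as ℤ
import Data.Integer.Tactic.RingSolver as ℤ-RingSolver
open import Data.Empty using (⊥-elim)
open import Relation.Binary.Definitions using (tri<; tri≈; tri>)
open import Relation.Binary.PropositionalEquality
open import Function.Base using (_∘_; id)

𝟙 : Bool → ℕ
𝟙 true = 1
𝟙 false = 0

𝟙-idem : ∀ b → 𝟙 b * 𝟙 b ≡ 𝟙 b
𝟙-idem true = refl
𝟙-idem false = refl

<⇒<ᵇ≡true : ∀ {m n} → m < n → (m <ᵇ n) ≡ true
<⇒<ᵇ≡true z<s = refl
<⇒<ᵇ≡true (s<s m<n@(s≤s _)) = <⇒<ᵇ≡true m<n

≥⇒<ᵇ≡false : ∀ {m n} → m ≥ n → (m <ᵇ n) ≡ false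
≥⇒<ᵇ≡false z≤n = refl
≥⇒<ᵇ≡false (s≤s n≤m) = ≥⇒<ᵇ≡false n≤m

<ᵇ-irrefl : ∀ n → (n <ᵇ n) ≡ false
<ᵇ-irrefl n = ≥⇒<ᵇ≡false (≤-refl {n})

module _ {A : Set} where

  sumBy : (A → ℕ) → List A → ℕ
  sumBy f [] = 0
  sumBy f (x ∷ xs) = f x + sumBy f xs

  sumSplits : (List A → A → List A → ℕ) → List A → ℕ
  sumSplits F [] = 0
  sumSplits F (x ∷ xs) = F [] x xs + sumSplits (λ p → F (x ∷ p)) xs

  sumPairs : (A → A → ℕ) → List A → ℕ
  sumPairs R = sumSplits (λ _ x s → sumBy (R x) s)

  sumTriples : (A → A → A → ℕ) → List A → ℕ
  sumTriples R = sumSplits (λ _ x s → sumPairs (R x) s)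

  private
    interchange : ∀ a b c d → a + b + (c + d) ≡ a + c + (b + d)
    interchange = solve-∀

  sumBy-+ : ∀ (f g : A → ℕ) l → sumBy (λ x → f x + g x) l ≡ sumBy f l + sumBy g l
  sumBy-+ f g [] = refl
  sumBy-+ f g (x ∷ l) rewrite sumBy-+ f g l = interchange (f x) (g x) (sumBy f l) (sumBy g l)

  sumBy-*ˡ : ∀ k (f : A → ℕ) l → sumBy (λ x → k * f x) l ≡ k * sumBy f l
  sumBy-*ˡ k f [] = sym (*-zeroʳ k)
  sumBy-*ˡ k f (x ∷ l) rewrite sumBy-*ˡ k f l = sym (*-distribˡ-+ k (f x) (sumBy f l))

  sumBy-++ : ∀ (f : A → ℕ) l m → sumBy f (l ++ m) ≡ sumBy f l + sumBy f m
  sumBy-++ f [] m = refl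
  sumBy-++ f (x ∷ l) m rewrite sumBy-++ f l m = sym (+-assoc (f x) _ _)

  sumBy-const : ∀ c (l : List A) → sumBy (λ _ → c) l ≡ c * length l
  sumBy-const c [] = sym (*-zeroʳ c)
  sumBy-const c (x ∷ l) = trans (cong (_+_ c) (sumBy-const c l)) (sym (*-suc c (length l)))

  sumBy-cong : ∀ {P : A → Set} {f g : A → ℕ} {l} → All P l → (∀ {x} → P x → f x ≡ g x) →
               sumBy f l ≡ sumBy g l
  sumBy-cong [] f≡g = refl
  sumBy-cong (px ∷ pxs) f≡g = cong₂ _+_ (f≡g px) (sumBy-cong pxs f≡g)

  sumBy-𝟙² : ∀ (b : A → Bool) l →
             sumBy (𝟙 ∘ b) l * sumBy (𝟙 ∘ b) l ≡ sumBy (𝟙 ∘ b) l + 2 * sumPairs (λ x y → 𝟙 (b x) * 𝟙 (b y)) l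
  sumBy-𝟙² b [] = refl
  sumBy-𝟙² b (x ∷ l) = begin
      (β + S) * (β + S)             ≡⟨ square-expand β S ⟩
      β * β + 2 * (β * S) + S * S   ≡⟨ cong₂ (λ u w → u + 2 * (β * S) + w) (𝟙-idem (b x)) (sumBy-𝟙² b l) ⟩
      β + 2 * (β * S) + (S + 2 * P) ≡⟨ cong (λ t → β + 2 * t + (S + 2 * P)) (sym (sumBy-*ˡ β (𝟙 ∘ b) l)) ⟩
      β + 2 * Q + (S + 2 * P)       ≡⟨ regroup β S Q P ⟩
      β + S + 2 * (Q + P)           ∎
    where
    open ≡-Reasoning
    β = 𝟙 (b x)
    S = sumBy (𝟙 ∘ b) l
    P = sumPairs (λ y z → 𝟙 (b y) * 𝟙 (b z)) l
    Q = sumBy (λ y → β * 𝟙 (b y)) l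
    square-expand : ∀ a c → (a + c) * (a + c) ≡ a * a + 2 * (a * c) + c * c
    square-expand = solve-∀
    regroup : ∀ a c e f → a + 2 * e + (c + 2 * f) ≡ a + c + 2 * (e + f)
    regroup = solve-∀

  AllPairs-split : ∀ {R : A → A → Set} p {x s} → AllPairs R (p ++ x ∷ s) → All (λ w → R w x) p × All (R x) s
  AllPairs-split [] (rx ∷ _) = [] , rx
  AllPairs-split (w ∷ p) (rw ∷ rs) = map₁ (All.head (All.++⁻ʳ p rw) ∷_) (AllPairs-split p rs)

  sumSplits-cong : ∀ {F G : List A → A → List A → ℕ} l → (∀ p x s → F p x s ≡ G p x s) →
                   sumSplits F l ≡ sumSplits G l
  sumSplits-cong [] F≡G = refl
  sumSplits-cong (x ∷ l) F≡G = cong₂ _+_ (F≡G [] x l) (sumSplits-cong l (λ p → F≡G (x ∷ p)))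

  sumSplits-+ : ∀ (F G : List A → A → List A → ℕ) l →
                sumSplits (λ p x s → F p x s + G p x s) l ≡ sumSplits F l + sumSplits G l
  sumSplits-+ F G [] = refl
  sumSplits-+ F G (x ∷ l) rewrite sumSplits-+ (λ p → F (x ∷ p)) (λ p → G (x ∷ p)) l =
    interchange (F [] x l) (G [] x l) (sumSplits (λ p → F (x ∷ p)) l) (sumSplits (λ p → G (x ∷ p)) l)

  sumSplits-*ˡ : ∀ k (F : List A → A → List A → ℕ) l → sumSplits (λ p x s → k * F p x s) l ≡ k * sumSplits F l
  sumSplits-*ˡ k F [] = sym (*-zeroʳ k)
  sumSplits-*ˡ k F (x ∷ l) rewrite sumSplits-*ˡ k (λ p → F (x ∷ p)) l = sym (*-distribˡ-+ k _ _)

  sumSplits-sumBy : ∀ (f : A → ℕ) l → sumSplits (λ _ x _ → f x) l ≡ sumBy f l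
  sumSplits-sumBy f [] = refl
  sumSplits-sumBy f (x ∷ l) = cong (_+_ (f x)) (sumSplits-sumBy f l)

  sumPairs-+ : ∀ (R R′ : A → A → ℕ) l → sumPairs (λ x y → R x y + R′ x y) l ≡ sumPairs R l + sumPairs R′ l
  sumPairs-+ R R′ l = trans (sumSplits-cong l (λ _ x s → sumBy-+ (R x) (R′ x) s)) (sumSplits-+ _ _ l)

  sumTriples-+ : ∀ (R R′ : A → A → A → ℕ) l →
                 sumTriples (λ x y z → R x y z + R′ x y z) l ≡ sumTriples R l + sumTriples R′ l
  sumTriples-+ R R′ l = trans (sumSplits-cong l (λ _ x s → sumPairs-+ (R x) (R′ x) s)) (sumSplits-+ _ _ l)

  sumPairs-cong : ∀ {P : A → A → Set} {R R′ : A → A → ℕ} {l} → AllPairs P l →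
                  (∀ {x y} → P x y → R x y ≡ R′ x y) → sumPairs R l ≡ sumPairs R′ l
  sumPairs-cong [] R≡R′ = refl
  sumPairs-cong (px ∷ ps) R≡R′ = cong₂ _+_ (sumBy-cong px R≡R′) (sumPairs-cong ps R≡R′)

  sumTriples-cong : ∀ {P : A → A → Set} {R R′ : A → A → A → ℕ} {l} → AllPairs P l →
                    (∀ {x y z} → P x y → P x z → P y z → R x y z ≡ R′ x y z) →
                    sumTriples R l ≡ sumTriples R′ l
  sumTriples-cong [] R≡R′ = refl
  sumTriples-cong {P} (px ∷ ps) R≡R′ =
    cong₂ _+_ (sumPairs-cong (pairsAfter px ps) (λ (pxy , pxz , pyz) → R≡R′ pxy pxz pyz))
              (sumTriples-cong ps R≡R′)
    where
    pairsAfter : ∀ {x l} → All (P x) l → AllPairs P l → AllPairs (λ y z → P x y × P x z × P y z) l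
    pairsAfter [] [] = []
    pairsAfter (pxy ∷ pxs) (py ∷ ps) =
      All.zipWith (λ (pxz , pyz) → pxy , pxz , pyz) (pxs , py) ∷ pairsAfter pxs ps

  sumSplits-prefix-sumBy : ∀ (K : A → A → ℕ) l →
                           sumSplits (λ p y _ → sumBy (K y) p) l ≡ sumPairs (λ x y → K y x) l
  sumSplits-prefix-sumBy K [] = refl
  sumSplits-prefix-sumBy K (x ∷ l) = begin
      sumSplits (λ p y _ → K y x + sumBy (K y) p) l
    ≡⟨ sumSplits-+ (λ _ y _ → K y x) (λ p y _ → sumBy (K y) p) l ⟩
      sumSplits (λ _ y _ → K y x) l + sumSplits (λ p y _ → sumBy (K y) p) l
    ≡⟨ cong₂ _+_ (sumSplits-sumBy (λ y → K y x) l) (sumSplits-prefix-sumBy K l) ⟩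
      sumBy (λ y → K y x) l + sumPairs (λ x y → K y x) l ∎
    where open ≡-Reasoning

  sumSplits-prefix-sumPairs : ∀ (K : A → A → A → ℕ) l →
                              sumSplits (λ p y _ → sumPairs (K y) p) l ≡ sumTriples (λ x y z → K z x y) l
  sumSplits-prefix-sumPairs K [] = refl
  sumSplits-prefix-sumPairs K (x ∷ l) = begin
      sumSplits (λ p y _ → sumBy (K y x) p + sumPairs (K y) p) l
    ≡⟨ sumSplits-+ (λ p y _ → sumBy (K y x) p) (λ p y _ → sumPairs (K y) p) l ⟩
      sumSplits (λ p y _ → sumBy (K y x) p) l + sumSplits (λ p y _ → sumPairs (K y) p) l
    ≡⟨ cong₂ _+_ (sumSplits-prefix-sumBy (λ y → K y x) l) (sumSplits-prefix-sumPairs K l) ⟩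
      sumPairs (λ y z → K z x y) l + sumTriples (λ x y z → K z x y) l ∎
    where open ≡-Reasoning

sumBy-map : ∀ {A B : Set} (f : B → ℕ) (g : A → B) l → sumBy f (map g l) ≡ sumBy (f ∘ g) l
sumBy-map f g [] = refl
sumBy-map f g (x ∷ l) = cong (_+_ (f (g x))) (sumBy-map f g l)

module _ {A : Set} where

  length-filter : ∀ (f : A → Bool) l → length (filter (λ x → f x ≟ᵇ true) l) ≡ sumBy (𝟙 ∘ f) l
  length-filter f [] = refl
  length-filter f (x ∷ l) with f x
  ... | true = cong suc (length-filter f l)
  ... | false = length-filter f l

  sumBy-choose-suc : ∀ k (h : Vec A (suc k) → ℕ) x xs →
    sumBy h (choose (suc k) (x ∷ xs)) ≡ sumBy (h ∘ (x ∷_)) (choose k xs) + sumBy h (choose (suc k) xs)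
  sumBy-choose-suc k h x xs = trans (sumBy-++ h (map (Vec._∷_ x) (choose k xs)) _)
                                    (cong (_+ sumBy h (choose (suc k) xs)) (sumBy-map h (Vec._∷_ x) (choose k xs)))

  sumBy-choose₁ : ∀ (h : Vec A 1 → ℕ) xs → sumBy h (choose 1 xs) ≡ sumBy (λ x → h (x ∷ [])) xs
  sumBy-choose₁ h [] = refl
  sumBy-choose₁ h (x ∷ xs) = trans (sumBy-choose-suc 0 h x xs)
                                   (cong₂ _+_ (+-identityʳ (h (x ∷ []))) (sumBy-choose₁ h xs))

  sumBy-choose₂ : ∀ (h : Vec A 2 → ℕ) xs → sumBy h (choose 2 xs) ≡ sumPairs (λ x y → h (x ∷ y ∷ [])) xs
  sumBy-choose₂ h [] = refl
  sumBy-choose₂ h (x ∷ xs) = trans (sumBy-choose-suc 1 h x xs)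
                                   (cong₂ _+_ (sumBy-choose₁ (h ∘ (x ∷_)) xs) (sumBy-choose₂ h xs))

  sumBy-choose₃ : ∀ (h : Vec A 3 → ℕ) xs → sumBy h (choose 3 xs) ≡ sumTriples (λ x y z → h (x ∷ y ∷ z ∷ [])) xs
  sumBy-choose₃ h [] = refl
  sumBy-choose₃ h (x ∷ xs) = trans (sumBy-choose-suc 2 h x xs)
                                   (cong₂ _+_ (sumBy-choose₂ (h ∘ (x ∷_)) xs) (sumBy-choose₃ h xs))

  sumℤ-sumSplits : ∀ (g : A → ℤ) (Q R : List A → A → List A → ℕ) l →
    (∀ p x s → p ++ x ∷ s ≡ l → g x ≡ + Q p x s ℤ.- + 2 ℤ.* + R p x s) →
    foldr ℤ._+_ (+ 0) (map g l) ≡ + sumSplits Q l ℤ.- + 2 ℤ.* + sumSplits R l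
  sumℤ-sumSplits g Q R [] _ = refl
  sumℤ-sumSplits g Q R (x ∷ l) g≡ = begin
      g x ℤ.+ foldr ℤ._+_ (+ 0) (map g l)
    ≡⟨ cong₂ ℤ._+_ (g≡ [] x l refl)
                   (sumℤ-sumSplits g (λ p → Q (x ∷ p)) (λ p → R (x ∷ p)) l
                                   (λ p y s eq → g≡ (x ∷ p) y s (cong (x ∷_) eq))) ⟩
      (+ q ℤ.- + 2 ℤ.* + r) ℤ.+ (+ q′ ℤ.- + 2 ℤ.* + r′)
    ≡⟨ regroup (+ q) (+ r) (+ q′) (+ r′) ⟩
      (+ q ℤ.+ + q′) ℤ.- + 2 ℤ.* (+ r ℤ.+ + r′)
    ≡⟨ sym (cong₂ (λ a b → a ℤ.- + 2 ℤ.* b) (ℤ.pos-+ q q′) (ℤ.pos-+ r r′)) ⟩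
      + (q + q′) ℤ.- + 2 ℤ.* + (r + r′) ∎
    where
    open ≡-Reasoning
    q = Q [] x l
    r = R [] x l
    q′ = sumSplits (λ p → Q (x ∷ p)) l
    r′ = sumSplits (λ p → R (x ∷ p)) l
    regroup : ∀ a b c d → (a ℤ.- + 2 ℤ.* b) ℤ.+ (c ℤ.- + 2 ℤ.* d) ≡ (a ℤ.+ c) ℤ.- + 2 ℤ.* (b ℤ.+ d)
    regroup = ℤ-RingSolver.solve-∀

module Inversions {A : Set} (v : A → ℕ) where

  below : A → A → ℕ
  below x y = 𝟙 (v x <ᵇ v y)

  countBelow : A → List A → ℕ
  countBelow y l = sumBy (λ z → below z y) l

  countAbove : A → List A → ℕ
  countAbove y l = sumBy (below y) l

  open ≡-Reasoning

  sumSplits-countBelow² : ∀ l →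
    sumSplits (λ _ y s → countBelow y s * countBelow y s) l
      ≡ sumPairs (λ x y → below y x) l + 2 * sumTriples (λ x y z → below y x * below z x) l
  sumSplits-countBelow² l = begin
      sumSplits (λ _ y s → countBelow y s * countBelow y s) l
    ≡⟨ sumSplits-cong l (λ _ y s → sumBy-𝟙² (λ z → v z <ᵇ v y) s) ⟩
      sumSplits (λ _ y s → countBelow y s + 2 * sumPairs (λ z w → below z y * below w y) s) l
    ≡⟨ sumSplits-+ _ _ l ⟩
      sumPairs (λ x y → below y x) l + sumSplits (λ _ y s → 2 * sumPairs (λ z w → below z y * below w y) s) l
    ≡⟨ cong (_+_ (sumPairs (λ x y → below y x) l)) (sumSplits-*ˡ 2 _ l) ⟩
      sumPairs (λ x y → below y x) l + 2 * sumTriples (λ x y z → below y x * below z x) l ∎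

  sumSplits-countAbove² : ∀ l →
    sumSplits (λ p y _ → countAbove y p * countAbove y p) l
      ≡ sumPairs (λ x y → below y x) l + 2 * sumTriples (λ x y z → below z x * below z y) l
  sumSplits-countAbove² l = begin
      sumSplits (λ p y _ → countAbove y p * countAbove y p) l
    ≡⟨ sumSplits-cong l (λ p y _ → sumBy-𝟙² (λ w → v y <ᵇ v w) p) ⟩
      sumSplits (λ p y _ → countAbove y p + 2 * sumPairs (λ w u → below y w * below y u) p) l
    ≡⟨ sumSplits-+ _ _ l ⟩
      sumSplits (λ p y _ → countAbove y p) l + sumSplits (λ p y _ → 2 * sumPairs (λ w u → below y w * below y u) p) l
    ≡⟨ cong₂ _+_ (sumSplits-prefix-sumBy below l) (sumSplits-*ˡ 2 _ l) ⟩
      sumPairs (λ x y → below y x) l + 2 * sumSplits (λ p y _ → sumPairs (λ w u → below y w * below y u) p) l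
    ≡⟨ cong (λ t → sumPairs (λ x y → below y x) l + 2 * t)
            (sumSplits-prefix-sumPairs (λ y w u → below y w * below y u) l) ⟩
      sumPairs (λ x y → below y x) l + 2 * sumTriples (λ x y z → below z x * below z y) l ∎

  sumSplits-countBelow*countAbove : ∀ l →
    sumSplits (λ p y s → countBelow y s * countAbove y p) l ≡ sumTriples (λ x y z → below y x * below z y) l
  sumSplits-countBelow*countAbove [] = refl
  sumSplits-countBelow*countAbove (x ∷ l) = begin
      countBelow x l * 0 + sumSplits (λ p y s → countBelow y s * (below y x + countAbove y p)) l
    ≡⟨ cong₂ _+_ (*-zeroʳ (countBelow x l)) (sumSplits-cong l (λ p y s → *-distribˡ-+ (countBelow y s) _ _)) ⟩
      sumSplits (λ p y s → countBelow y s * below y x + countBelow y s * countAbove y p) l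
    ≡⟨ sumSplits-+ _ _ l ⟩
      sumSplits (λ _ y s → countBelow y s * below y x) l + sumSplits (λ p y s → countBelow y s * countAbove y p) l
    ≡⟨ cong₂ _+_ (sumSplits-cong l first-below-x) (sumSplits-countBelow*countAbove l) ⟩
      sumPairs (λ y z → below y x * below z y) l + sumTriples (λ x y z → below y x * below z y) l ∎
    where
    first-below-x : ∀ p y s → countBelow y s * below y x ≡ sumBy (λ z → below y x * below z y) s
    first-below-x _ y s = trans (*-comm (countBelow y s) (below y x))
                                (sym (sumBy-*ˡ (below y x) (λ z → below z y) s))

  countBelow-split : ∀ p x s → countBelow x (p ++ x ∷ s) ≡ countBelow x p + countBelow x s
  countBelow-split p x s = begin
      countBelow x (p ++ x ∷ s)
    ≡⟨ sumBy-++ (λ z → below z x) p (x ∷ s) ⟩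
      countBelow x p + (𝟙 (v x <ᵇ v x) + countBelow x s)
    ≡⟨ cong (λ b → countBelow x p + (𝟙 b + countBelow x s)) (<ᵇ-irrefl (v x)) ⟩
      countBelow x p + countBelow x s ∎

  countBelow-increasing : ∀ p x s → AllPairs (λ a b → v a < v b) (p ++ x ∷ s) →
                          countBelow x (p ++ x ∷ s) ≡ length p
  countBelow-increasing p x s increasing = begin
      countBelow x (p ++ x ∷ s)
    ≡⟨ countBelow-split p x s ⟩
      countBelow x p + countBelow x s
    ≡⟨ cong₂ _+_ (sumBy-cong before (cong 𝟙 ∘ <⇒<ᵇ≡true)) (sumBy-cong after (cong 𝟙 ∘ ≥⇒<ᵇ≡false ∘ <⇒≤)) ⟩
      sumBy (λ _ → 1) p + sumBy (λ _ → 0) s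
    ≡⟨ cong₂ _+_ (sumBy-const 1 p) (sumBy-const 0 s) ⟩
      1 * length p + 0
    ≡⟨ trans (+-identityʳ _) (*-identityˡ _) ⟩
      length p ∎
    where
    before = proj₁ (AllPairs-split p increasing)
    after = proj₂ (AllPairs-split p increasing)

  countBelow+countAbove : ∀ {x l} → All (λ w → v w ≢ v x) l → countBelow x l + countAbove x l ≡ length l
  countBelow+countAbove {x} {l} distinct = begin
      countBelow x l + countAbove x l
    ≡⟨ sym (sumBy-+ (λ w → below w x) (below x) l) ⟩
      sumBy (λ w → below w x + below x w) l
    ≡⟨ sumBy-cong distinct exactly-one ⟩
      sumBy (λ _ → 1) l
    ≡⟨ trans (sumBy-const 1 l) (*-identityˡ _) ⟩
      length l ∎
    where
    exactly-one : ∀ {a b} → a ≢ b → 𝟙 (a <ᵇ b) + 𝟙 (b <ᵇ a) ≡ 1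
    exactly-one {a} {b} a≢b with <-cmp a b
    ... | tri< a<b _ _ rewrite <⇒<ᵇ≡true a<b | ≥⇒<ᵇ≡false (<⇒≤ a<b) = refl
    ... | tri≈ _ a≡b _ = ⊥-elim (a≢b a≡b)
    ... | tri> _ _ b<a rewrite <⇒<ᵇ≡true b<a | ≥⇒<ᵇ≡false (<⇒≤ b<a) = refl

-- For k = 2, 3, orderIso σ π is unfolds definitionally to isPattern π applied to the values of σ at is.
isPattern : ∀ {k} → Permutation′ k → Vec ℕ k → Bool
isPattern {k} π w = allPairs k (λ a b → (lookup w a <ᵇ lookup w b) ==ᵇ (toℕ (π ⟨$⟩ʳ a) <ᵇ toℕ (π ⟨$⟩ʳ b)))

isPattern-21 : ∀ {x y} → x ≢ y → 𝟙 (isPattern p21 (x ∷ y ∷ [])) ≡ 𝟙 (y <ᵇ x)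
isPattern-21 {x} {y} x≢y with <-cmp x y
... | tri< x<y _ _ rewrite <ᵇ-irrefl x | <ᵇ-irrefl y | <⇒<ᵇ≡true x<y | ≥⇒<ᵇ≡false (<⇒≤ x<y) = refl
... | tri≈ _ x≡y _ = ⊥-elim (x≢y x≡y)
... | tri> _ _ y<x rewrite <ᵇ-irrefl x | <ᵇ-irrefl y | <⇒<ᵇ≡true y<x | ≥⇒<ᵇ≡false (<⇒≤ y<x) = refl

data Order₃ (x y z : ℕ) : Set where
  x<y<z : x < y → y < z → x < z → Order₃ x y z
  x<z<y : x < z → z < y → x < y → Order₃ x y z
  y<x<z : y < x → x < z → y < z → Order₃ x y z
  y<z<x : y < z → z < x → y < x → Order₃ x y z
  z<x<y : z < x → x < y → z < y → Order₃ x y z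
  z<y<x : z < y → y < x → z < x → Order₃ x y z

order₃ : ∀ {x y z} → x ≢ y → x ≢ z → y ≢ z → Order₃ x y z
order₃ {x} {y} {z} x≢y x≢z y≢z with <-cmp x y | <-cmp y z
... | tri≈ _ x≡y _ | _            = ⊥-elim (x≢y x≡y)
... | _            | tri≈ _ y≡z _ = ⊥-elim (y≢z y≡z)
... | tri< x<y _ _ | tri< y<z _ _ = x<y<z x<y y<z (<-trans x<y y<z)
... | tri> _ _ y<x | tri> _ _ z<y = z<y<x z<y y<x (<-trans z<y y<x)
... | tri< x<y _ _ | tri> _ _ z<y with <-cmp x z
...   | tri< x<z _ _ = x<z<y x<z z<y x<y
...   | tri≈ _ x≡z _ = ⊥-elim (x≢z x≡z)
...   | tri> _ _ z<x = z<x<y z<x x<y z<y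
order₃ {x} {y} {z} x≢y x≢z y≢z | tri> _ _ y<x | tri< y<z _ _ with <-cmp x z
...   | tri< x<z _ _ = y<x<z y<x x<z y<z
...   | tri≈ _ x≡z _ = ⊥-elim (x≢z x≡z)
...   | tri> _ _ z<x = y<z<x y<z z<x y<x

TriplePatterns : ℕ → ℕ → ℕ → Set
TriplePatterns x y z =
  (𝟙 (isPattern p312 w) + 𝟙 (isPattern p321 w) ≡ 𝟙 (y <ᵇ x) * 𝟙 (z <ᵇ x)) ×
  (𝟙 (isPattern p231 w) + 𝟙 (isPattern p321 w) ≡ 𝟙 (z <ᵇ x) * 𝟙 (z <ᵇ y)) ×
  (𝟙 (isPattern p321 w) ≡ 𝟙 (y <ᵇ x) * 𝟙 (z <ᵇ y))
  where w = x ∷ y ∷ z ∷ []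

triplePatterns : ∀ {x y z} → Order₃ x y z → TriplePatterns x y z
triplePatterns {x} {y} {z} o rewrite <ᵇ-irrefl x | <ᵇ-irrefl y | <ᵇ-irrefl z with o
... | x<y<z a b c rewrite ≥⇒<ᵇ≡false (<⇒≤ a) | ≥⇒<ᵇ≡false (<⇒≤ b) | ≥⇒<ᵇ≡false (<⇒≤ c)
                        | <⇒<ᵇ≡true a | <⇒<ᵇ≡true b | <⇒<ᵇ≡true c = refl , refl , refl
... | x<z<y a b c rewrite ≥⇒<ᵇ≡false (<⇒≤ a) | ≥⇒<ᵇ≡false (<⇒≤ b) | ≥⇒<ᵇ≡false (<⇒≤ c)
                        | <⇒<ᵇ≡true a | <⇒<ᵇ≡true c = refl , refl , refl
... | y<x<z a b c rewrite ≥⇒<ᵇ≡false (<⇒≤ a) | ≥⇒<ᵇ≡false (<⇒≤ b) | ≥⇒<ᵇ≡false (<⇒≤ c)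
                        | <⇒<ᵇ≡true a | <⇒<ᵇ≡true b = refl , refl , refl
... | y<z<x a b c rewrite ≥⇒<ᵇ≡false (<⇒≤ a) | ≥⇒<ᵇ≡false (<⇒≤ b) | ≥⇒<ᵇ≡false (<⇒≤ c)
                        | <⇒<ᵇ≡true a | <⇒<ᵇ≡true b | <⇒<ᵇ≡true c = refl , refl , refl
... | z<x<y a b c rewrite ≥⇒<ᵇ≡false (<⇒≤ a) | ≥⇒<ᵇ≡false (<⇒≤ b) | ≥⇒<ᵇ≡false (<⇒≤ c)
                        | <⇒<ᵇ≡true a | <⇒<ᵇ≡true b | <⇒<ᵇ≡true c = refl , refl , refl
... | z<y<x a b c rewrite ≥⇒<ᵇ≡false (<⇒≤ a) | ≥⇒<ᵇ≡false (<⇒≤ b) | ≥⇒<ᵇ≡false (<⇒≤ c)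
                        | <⇒<ᵇ≡true a | <⇒<ᵇ≡true b | <⇒<ᵇ≡true c = refl , refl , refl

sumBy-allFin : ∀ {n} (f : Fin n → ℕ) → sumBy f (allFin n) ≡ sum f
sumBy-allFin f = sumBy-tabulate f id
  where
  sumBy-tabulate : ∀ {m n} (f : Fin n → ℕ) (g : Fin m → Fin n) → sumBy f (tabulate g) ≡ sum (f ∘ g)
  sumBy-tabulate {zero} f g = refl
  sumBy-tabulate {suc m} f g = cong (_+_ (f (g Fin.zero))) (sumBy-tabulate f (g ∘ Fin.suc))

sumBy-allFin-permute : ∀ {n} (σ : Permutation′ n) (f : Fin n → ℕ) →
                       sumBy (f ∘ (σ ⟨$⟩ʳ_)) (allFin n) ≡ sumBy f (allFin n)
sumBy-allFin-permute {n} σ f = begin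
    sumBy (f ∘ (σ ⟨$⟩ʳ_)) (allFin n) ≡⟨ sumBy-allFin (f ∘ (σ ⟨$⟩ʳ_)) ⟩
    sum (f ∘ (σ ⟨$⟩ʳ_))             ≡⟨ sum-permute f σ ⟨
    sum f                           ≡⟨ sumBy-allFin f ⟨
    sumBy f (allFin n)              ∎
  where open ≡-Reasoning

sumBy-allFin-<ᵇ : ∀ {n k} → k ≤ n → sumBy (λ (w : Fin n) → 𝟙 (toℕ w <ᵇ k)) (allFin n) ≡ k
sumBy-allFin-<ᵇ {n} {k} k≤n = trans (sumBy-allFin (λ (w : Fin n) → 𝟙 (toℕ w <ᵇ k))) (count k≤n)
  where
  count : ∀ {n k} → k ≤ n → sum (λ (w : Fin n) → 𝟙 (toℕ w <ᵇ k)) ≡ k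
  count {zero} z≤n = refl
  count {suc n} z≤n = count {n} z≤n
  count {suc n} (s≤s k≤n) = cong suc (count k≤n)

allFin-increasing : ∀ n → AllPairs (λ i j → toℕ i < toℕ j) (allFin n)
allFin-increasing n = tabulate⁺-< id

square-difference : ∀ a b → (+ a ℤ.- + b) ℤ.* (+ a ℤ.- + b) ≡ + (a * a + b * b) ℤ.- + 2 ℤ.* + (a * b)
square-difference a b = begin
    (+ a ℤ.- + b) ℤ.* (+ a ℤ.- + b)
  ≡⟨ expand (+ a) (+ b) ⟩
    (+ a ℤ.* + a ℤ.+ + b ℤ.* + b) ℤ.- + 2 ℤ.* (+ a ℤ.* + b)
  ≡⟨ cong₂ (λ u w → u ℤ.- + 2 ℤ.* w)
           (sym (trans (ℤ.pos-+ (a * a) (b * b)) (cong₂ ℤ._+_ (ℤ.pos-* a a) (ℤ.pos-* b b))))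
           (sym (ℤ.pos-* a b)) ⟩
    + (a * a + b * b) ℤ.- + 2 ℤ.* + (a * b) ∎
  where
  open ≡-Reasoning
  expand : ∀ x y → (x ℤ.- y) ℤ.* (x ℤ.- y) ≡ (x ℤ.* x ℤ.+ y ℤ.* y) ℤ.- + 2 ℤ.* (x ℤ.* y)
  expand = ℤ-RingSolver.solve-∀

2m+2n-2n≡2m : ∀ m n → + (2 * m + 2 * n) ℤ.- + 2 ℤ.* + n ≡ + 2 ℤ.* + m
2m+2n-2n≡2m m n = begin
    + (2 * m + 2 * n) ℤ.- + 2 ℤ.* + n
  ≡⟨ cong (ℤ._- + 2 ℤ.* + n) (trans (ℤ.pos-+ (2 * m) (2 * n)) (cong₂ ℤ._+_ (ℤ.pos-* 2 m) (ℤ.pos-* 2 n))) ⟩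
    (+ 2 ℤ.* + m ℤ.+ + 2 ℤ.* + n) ℤ.- + 2 ℤ.* + n
  ≡⟨ cancel (+ m) (+ n) ⟩
    + 2 ℤ.* + m ∎
  where
  open ≡-Reasoning
  cancel : ∀ x y → (+ 2 ℤ.* x ℤ.+ + 2 ℤ.* y) ℤ.- + 2 ℤ.* y ≡ + 2 ℤ.* x
  cancel = ℤ-RingSolver.solve-∀

value : ∀ {n} → Permutation′ n → Fin n → ℕ
value σ i = toℕ (σ ⟨$⟩ʳ i)

module _ {n : ℕ} (σ : Permutation′ n) where
  open Inversions (value σ)
  private
    module Position = Inversions (toℕ {n})
  open ≡-Reasoning

  values-distinct : AllPairs (λ i j → value σ i ≢ value σ j) (allFin n)
  values-distinct = AllPairs.map (λ i<j vi≡vj → <-irrefl (cong toℕ (σ-injective (toℕ-injective vi≡vj))) i<j)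
                                 (allFin-increasing n)
    where
    σ-injective : ∀ {i j} → σ ⟨$⟩ʳ i ≡ σ ⟨$⟩ʳ j → i ≡ j
    σ-injective e = trans (sym (inverseˡ σ)) (trans (cong (σ ⟨$⟩ˡ_) e) (inverseˡ σ))

  displacement : ∀ p x s → p ++ x ∷ s ≡ allFin n →
                 + value σ x ℤ.- + toℕ x ≡ + countBelow x s ℤ.- + countAbove x p
  displacement p x s split = begin
      + value σ x ℤ.- + toℕ x
    ≡⟨ cong₂ (λ a b → + a ℤ.- + b) value-split position-split ⟩
      + (countBelow x p + countBelow x s) ℤ.- + (countBelow x p + countAbove x p)
    ≡⟨ cong₂ ℤ._-_ (ℤ.pos-+ (countBelow x p) (countBelow x s)) (ℤ.pos-+ (countBelow x p) (countAbove x p)) ⟩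
      (+ countBelow x p ℤ.+ + countBelow x s) ℤ.- (+ countBelow x p ℤ.+ + countAbove x p)
    ≡⟨ cancel (+ countBelow x p) (+ countBelow x s) (+ countAbove x p) ⟩
      + countBelow x s ℤ.- + countAbove x p ∎
    where
    cancel : ∀ c a b → (c ℤ.+ a) ℤ.- (c ℤ.+ b) ≡ a ℤ.- b
    cancel = ℤ-RingSolver.solve-∀
    value-split : value σ x ≡ countBelow x p + countBelow x s
    value-split = begin
        value σ x
      ≡⟨ sumBy-allFin-<ᵇ (<⇒≤ (toℕ<n (σ ⟨$⟩ʳ x))) ⟨
        sumBy (λ w → 𝟙 (toℕ w <ᵇ value σ x)) (allFin n)
      ≡⟨ sumBy-allFin-permute σ _ ⟨
        countBelow x (allFin n)
      ≡⟨ cong (countBelow x) split ⟨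
        countBelow x (p ++ x ∷ s)
      ≡⟨ countBelow-split p x s ⟩
        countBelow x p + countBelow x s ∎
    position-split : toℕ x ≡ countBelow x p + countAbove x p
    position-split = begin
        toℕ x
      ≡⟨ sumBy-allFin-<ᵇ (<⇒≤ (toℕ<n x)) ⟨
        Position.countBelow x (allFin n)
      ≡⟨ cong (Position.countBelow x) split ⟨
        Position.countBelow x (p ++ x ∷ s)
      ≡⟨ Position.countBelow-increasing p x s (subst (AllPairs _) (sym split) (allFin-increasing n)) ⟩
        length p
      ≡⟨ countBelow+countAbove (proj₁ (AllPairs-split p (subst (AllPairs _) (sym split) values-distinct))) ⟨
        countBelow x p + countAbove x p ∎

  N-sumPairs : ∀ π → N π σ ≡ sumPairs (λ i j → 𝟙 (orderIso σ π (i ∷ j ∷ []))) (allFin n)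
  N-sumPairs π = trans (length-filter (orderIso σ π) (choose 2 (allFin n)))
                       (sumBy-choose₂ (𝟙 ∘ orderIso σ π) (allFin n))

  N-sumTriples : ∀ π → N π σ ≡ sumTriples (λ i j k → 𝟙 (orderIso σ π (i ∷ j ∷ k ∷ []))) (allFin n)
  N-sumTriples π = trans (length-filter (orderIso σ π) (choose 3 (allFin n)))
                         (sumBy-choose₃ (𝟙 ∘ orderIso σ π) (allFin n))

  sumTriples-N+N : ∀ π π′ →
    sumTriples (λ i j k → 𝟙 (orderIso σ π (i ∷ j ∷ k ∷ [])) + 𝟙 (orderIso σ π′ (i ∷ j ∷ k ∷ []))) (allFin n)
      ≡ N π σ + N π′ σ
  sumTriples-N+N π π′ = trans (sumTriples-+ _ _ (allFin n))
                              (sym (cong₂ _+_ (N-sumTriples π) (N-sumTriples π′)))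

  inversions≡N21 : sumPairs (λ x y → below y x) (allFin n) ≡ N p21 σ
  inversions≡N21 = sym (trans (N-sumPairs p21)
    (sumPairs-cong values-distinct (λ {i} {j} → isPattern-21 {value σ i} {value σ j})))

  private
    triplePatterns′ : ∀ {i j k} → value σ i ≢ value σ j → value σ i ≢ value σ k → value σ j ≢ value σ k →
                      TriplePatterns (value σ i) (value σ j) (value σ k)
    triplePatterns′ i≢j i≢k j≢k = triplePatterns (order₃ i≢j i≢k j≢k)

  firstLargest≡N312+N321 : sumTriples (λ x y z → below y x * below z x) (allFin n) ≡ N p312 σ + N p321 σ
  firstLargest≡N312+N321 = begin
      sumTriples (λ x y z → below y x * below z x) (allFin n)
    ≡⟨ sumTriples-cong values-distinct (λ i≢j i≢k j≢k → sym (proj₁ (triplePatterns′ i≢j i≢k j≢k))) ⟩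
      sumTriples (λ i j k → 𝟙 (orderIso σ p312 (i ∷ j ∷ k ∷ [])) + 𝟙 (orderIso σ p321 (i ∷ j ∷ k ∷ []))) (allFin n)
    ≡⟨ sumTriples-N+N p312 p321 ⟩
      N p312 σ + N p321 σ ∎

  lastSmallest≡N231+N321 : sumTriples (λ x y z → below z x * below z y) (allFin n) ≡ N p231 σ + N p321 σ
  lastSmallest≡N231+N321 = begin
      sumTriples (λ x y z → below z x * below z y) (allFin n)
    ≡⟨ sumTriples-cong values-distinct (λ i≢j i≢k j≢k → sym (proj₁ (proj₂ (triplePatterns′ i≢j i≢k j≢k)))) ⟩
      sumTriples (λ i j k → 𝟙 (orderIso σ p231 (i ∷ j ∷ k ∷ [])) + 𝟙 (orderIso σ p321 (i ∷ j ∷ k ∷ []))) (allFin n)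
    ≡⟨ sumTriples-N+N p231 p321 ⟩
      N p231 σ + N p321 σ ∎

  decreasing≡N321 : sumTriples (λ x y z → below y x * below z y) (allFin n) ≡ N p321 σ
  decreasing≡N321 = sym (trans (N-sumTriples p321)
    (sumTriples-cong values-distinct (λ i≢j i≢k j≢k → proj₂ (proj₂ (triplePatterns′ i≢j i≢k j≢k)))))

  sumSplits-squares :
    sumSplits (λ p x s → countBelow x s * countBelow x s + countAbove x p * countAbove x p) (allFin n)
      ≡ 2 * (N p21 σ + N p231 σ + N p312 σ + N p321 σ) + 2 * N p321 σ
  sumSplits-squares = begin
      sumSplits (λ p x s → countBelow x s * countBelow x s + countAbove x p * countAbove x p) (allFin n)
    ≡⟨ sumSplits-+ _ _ (allFin n) ⟩
      sumSplits (λ _ x s → countBelow x s * countBelow x s) (allFin n)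
        + sumSplits (λ p x _ → countAbove x p * countAbove x p) (allFin n)
    ≡⟨ cong₂ _+_ (sumSplits-countBelow² (allFin n)) (sumSplits-countAbove² (allFin n)) ⟩
      sumPairs (λ x y → below y x) (allFin n) + 2 * sumTriples (λ x y z → below y x * below z x) (allFin n)
        + (sumPairs (λ x y → below y x) (allFin n) + 2 * sumTriples (λ x y z → below z x * below z y) (allFin n))
    ≡⟨ cong₂ _+_ (cong₂ (λ a b → a + 2 * b) inversions≡N21 firstLargest≡N312+N321)
                 (cong₂ (λ a b → a + 2 * b) inversions≡N21 lastSmallest≡N231+N321) ⟩
      N p21 σ + 2 * (N p312 σ + N p321 σ) + (N p21 σ + 2 * (N p231 σ + N p321 σ))
    ≡⟨ regroup (N p21 σ) (N p231 σ) (N p312 σ) (N p321 σ) ⟩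
      2 * (N p21 σ + N p231 σ + N p312 σ + N p321 σ) + 2 * N p321 σ ∎
    where
    regroup : ∀ a b c d → a + 2 * (c + d) + (a + 2 * (b + d)) ≡ 2 * (a + b + c + d) + 2 * d
    regroup = solve-∀

  sumSplits-products : sumSplits (λ p x s → countBelow x s * countAbove x p) (allFin n) ≡ N p321 σ
  sumSplits-products = trans (sumSplits-countBelow*countAbove (allFin n)) decreasing≡N321

theorem3p4 : (n : ℕ) → (σ : Permutation′ n) →
    V σ ≡ + 2 ℤ.* + (N p21 σ + N p231 σ + N p312 σ + N p321 σ)
theorem3p4 n σ = begin
    V σ
  ≡⟨ sumℤ-sumSplits _ squares products (allFin n) square-displacement ⟩
    + sumSplits squares (allFin n) ℤ.- + 2 ℤ.* + sumSplits products (allFin n)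
  ≡⟨ cong₂ (λ a b → + a ℤ.- + 2 ℤ.* + b) (sumSplits-squares σ) (sumSplits-products σ) ⟩
    + (2 * total + 2 * N p321 σ) ℤ.- + 2 ℤ.* + N p321 σ
  ≡⟨ 2m+2n-2n≡2m total (N p321 σ) ⟩
    + 2 ℤ.* + total ∎
  where
  open ≡-Reasoning
  open Inversions (value σ)
  total : ℕ
  total = N p21 σ + N p231 σ + N p312 σ + N p321 σ
  squares products : List (Fin n) → Fin n → List (Fin n) → ℕ
  squares p x s = countBelow x s * countBelow x s + countAbove x p * countAbove x p
  products p x s = countBelow x s * countAbove x p
  square-displacement : ∀ p x s → p ++ x ∷ s ≡ allFin n →
    (+ value σ x ℤ.- + toℕ x) ℤ.* (+ value σ x ℤ.- + toℕ x) ≡ + squares p x s ℤ.- + 2 ℤ.* + products p x s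
  square-displacement p x s split =
    trans (cong (λ d → d ℤ.* d) (displacement σ p x s split))
          (square-difference (countBelow x s) (countAbove x p))
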